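{- Let $h$ and $n$ be positive integers with $n\geq 10h$. Let $G$ be a bipartite graph with partite sets $U,V$ and let $W\subseteq U\cup V$ with $|W|=h$. Suppose $\left(\frac12-\frac{1}{10h}\right)n\leq |U|,|V|\leq\left(\frac12+\frac{1}{10h}\right)n$ and $\delta(G)\geq\left(\frac12-\frac{1}{10h}\right)n$. Then: (i) for every $u\in U$, $v\in V$ and every odd integer $l$ with $3\leq l\leq h$, there is a path $P$ from $u$ to $v$ of length $l$ with $(V(P)\setminus\{u,v\})\cap W=\emptyset$; (ii) for every two distinct $u,v\in U$ and every even integer $l$ with $2\leq l\leq h$, there is a path $P$ from $u$ to $v$ of length $l$ with $(V(P)\setminus\{u,v\})\cap W=\emptyset$.
   Context: $\delta(G)$ denotes the minimum degree of $G$; the length of a path is its number of edges. -}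

module Defs where

open import Data.Nat using (ℕ; zero; suc; _+_; _*_; _∸_; _≤_)
open import Data.Bool using (Bool; true; false)
open import Data.Fin using (Fin; zero; suc; fromℕ; inject₁)
open import Data.Fin.Subset using (Subset; _∈_; ∣_∣)
open import Data.List using (List; length; filter)
open import Data.List using () renaming (allFin to allFinL)
open import Data.Product using (Σ; _×_; ∃; ∃-syntax)
open import Data.Sum using (_⊎_)
open import Relation.Binary.PropositionalEquality using (_≡_; _≢_)
open import Relation.Nullary using (¬_)
open import Data.Bool using (T)
open import Relation.Nullary.Decidable using (Dec; yes; no)
open import Data.Bool.Properties using () renaming (_≟_ to _≟B_)
open import Function.Definitions using (Injective)

record Graph (N : ℕ) : Set where
  field
    adj   : Fin N → Fin N → Bool
    sym   : ∀ x y → adj x y ≡ adj y x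
    irrefl : ∀ x → adj x x ≡ false
open Graph public

degree : ∀ {N} → Graph N → Fin N → ℕ
degree G x = length (filter (λ y → adj G x y ≟B true) (allFinL _))

-- Bipartition: side x ≡ true means x ∈ U, side x ≡ false means x ∈ V;
-- every edge joins U and V.
IsBipartition : ∀ {N} → Graph N → (Fin N → Bool) → Set
IsBipartition G side = ∀ x y → adj G x y ≡ true → side x ≢ side y

sizeU : ∀ {N} → (Fin N → Bool) → ℕ
sizeU side = length (filter (λ x → side x ≟B true) (allFinL _))

sizeV : ∀ {N} → (Fin N → Bool) → ℕ
sizeV side = length (filter (λ x → side x ≟B false) (allFinL _))

record Path {N} (G : Graph N) (l : ℕ) (u v : Fin N) : Set where
  field
    vtx   : Fin (suc l) → Fin N
    inj   : Injective _≡_ _≡_ vtx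
    start : vtx zero ≡ u
    end   : vtx (fromℕ l) ≡ v
    edges : ∀ (i : Fin l) → adj G (vtx (inject₁ i)) (vtx (suc i)) ≡ true
open Path public

AvoidsInterior : ∀ {N} {G : Graph N} {l u v} → Path G l u v → Subset N → Set
AvoidsInterior {u = u} {v} P W =
  ∀ i → vtx P i ∈ W → (vtx P i ≡ u) ⊎ (vtx P i ≡ v)

Odd : ℕ → Set
Odd l = ∃[ k ] l ≡ suc (2 * k)

Even : ℕ → Set
Even l = ∃[ k ] l ≡ 2 * k

-- After multiplying through by 10h, the degree bound gives every vertex more than 2h
-- neighbours, and inclusion–exclusion inside V gives any two vertices of U more than 2h
-- common neighbours (10h·|N(x) ∩ N(y)| ≥ 2(5h−1)n − (5h+1)n = (5h−3)n > 20h² once h ≥ 2).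
-- A path of length l is then grown backwards from v: l − 2 times step to a neighbour outside
-- W ∪ {u} and the vertices used so far (fewer than 2h vertices are forbidden), and close it
-- through a fresh common neighbour of u and the current end, which lies in U by parity.
module Submission where

open import Defs hiding (sym)
open import Data.Nat using (ℕ; zero; suc; _+_; _*_; _∸_; _≤_; _<_; _≥_; z≤n; s≤s; NonZero)
open import Data.Nat.Properties
open import Data.Nat.GeneralisedArithmetic using (fold)
open import Data.Nat.Tactic.RingSolver using (solve-∀)
open import Data.Bool using (Bool; true; false; not)
open import Data.Bool.Properties using (¬-not; not-involutive) renaming (_≟_ to _≟B_)
open import Data.Fin using (Fin; zero; suc; inject₁)
open import Data.Fin.Properties using (any?)
open import Data.Fin.Subset using (Subset; _∈_; _∉_; _⊆_; _∪_; _∩_; ⁅_⁆; ∣_∣)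
open import Data.Fin.Subset.Properties
  using (_∈?_; p⊆q⇒∣p∣≤∣q∣; ∣⁅x⁆∣≡1; x∈⁅x⁆; x∈p∪q⁺; x∈p∪q⁻; x∈p∩q⁻)
open import Data.Vec using ([]; _∷_; tabulate)
open import Data.Vec.Properties using (lookup∘tabulate; tabulate-cong; []=⇒lookup; lookup⇒[]=)
open import Data.List as List using (length; filter)
open import Data.Product using (∃; _×_; _,_; proj₁; proj₂)
open import Data.Sum using (inj₁; inj₂; [_,_])
open import Function using (_∘_; id)
open import Relation.Binary.PropositionalEquality using (_≡_; _≢_; refl; sym; trans; cong; subst)
open import Relation.Nullary using (does; yes; no; contradiction)
open import Relation.Nullary.Decidable using (_×-dec_; ¬?)
open import Relation.Unary using (Pred; Decidable)

private
  variable
    n N m : ℕ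

∣p∩q∣+∣p∪q∣≡∣p∣+∣q∣ : ∀ (p q : Subset n) → ∣ p ∩ q ∣ + ∣ p ∪ q ∣ ≡ ∣ p ∣ + ∣ q ∣
∣p∩q∣+∣p∪q∣≡∣p∣+∣q∣ []          []          = refl
∣p∩q∣+∣p∪q∣≡∣p∣+∣q∣ (true ∷ p)  (true ∷ q)  =
  cong suc (trans (+-suc _ _) (trans (cong suc (∣p∩q∣+∣p∪q∣≡∣p∣+∣q∣ p q)) (sym (+-suc _ _))))
∣p∩q∣+∣p∪q∣≡∣p∣+∣q∣ (true ∷ p)  (false ∷ q) = trans (+-suc _ _) (cong suc (∣p∩q∣+∣p∪q∣≡∣p∣+∣q∣ p q))
∣p∩q∣+∣p∪q∣≡∣p∣+∣q∣ (false ∷ p) (true ∷ q)  =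
  trans (+-suc _ _) (trans (cong suc (∣p∩q∣+∣p∪q∣≡∣p∣+∣q∣ p q)) (sym (+-suc _ _)))
∣p∩q∣+∣p∪q∣≡∣p∣+∣q∣ (false ∷ p) (false ∷ q) = ∣p∩q∣+∣p∪q∣≡∣p∣+∣q∣ p q

∣p∪q∣≤∣p∣+∣q∣ : ∀ (p q : Subset n) → ∣ p ∪ q ∣ ≤ ∣ p ∣ + ∣ q ∣
∣p∪q∣≤∣p∣+∣q∣ p q = ≤-trans (m≤n+m _ _) (≤-reflexive (∣p∩q∣+∣p∪q∣≡∣p∣+∣q∣ p q))

pigeonhole : {p q : Subset n} → ∣ p ∣ < ∣ q ∣ → ∃ λ x → x ∈ q × x ∉ p
pigeonhole {p = p} {q} ∣p∣<∣q∣ with any? (λ x → (x ∈? q) ×-dec ¬? (x ∈? p))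
... | yes found = found
... | no none   = contradiction (p⊆q⇒∣p∣≤∣q∣ q⊆p) (<⇒≱ ∣p∣<∣q∣)
  where
  q⊆p : q ⊆ p
  q⊆p {x} x∈q with x ∈? p
  ... | yes x∈p = x∈p
  ... | no  x∉p = contradiction (x , x∈q , x∉p) none

∈-tabulate⁻ : {f : Fin n → Bool} {x : Fin n} → x ∈ tabulate f → f x ≡ true
∈-tabulate⁻ {f = f} {x} x∈ = trans (sym (lookup∘tabulate f x)) ([]=⇒lookup x∈)

∈-tabulate⁺ : {f : Fin n → Bool} {x : Fin n} → f x ≡ true → x ∈ tabulate f
∈-tabulate⁺ {f = f} {x} fx = lookup⇒[]= x _ (trans (lookup∘tabulate f x) fx)

length-filter-tabulate : ∀ {a ℓ} {A : Set a} {P : Pred A ℓ} (P? : Decidable P) (g : Fin n → A) →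
  length (filter P? (List.tabulate g)) ≡ ∣ tabulate (does ∘ P? ∘ g) ∣
length-filter-tabulate {zero}  P? g = refl
length-filter-tabulate {suc n} P? g with does (P? (g zero))
... | true  = cong suc (length-filter-tabulate P? (g ∘ suc))
... | false = length-filter-tabulate P? (g ∘ suc)

m<d-by-scaling : ∀ {m a H n d} .{{_ : NonZero H}} → m < a → H ≤ n → a * n ≤ H * d → m < d
m<d-by-scaling {m} {a} {H} {n} {d} m<a H≤n an≤Hd = *-cancelˡ-< H m d (begin-strict
  H * m <⟨ *-monoʳ-< H m<a ⟩
  H * a ≡⟨ *-comm H a ⟩
  a * H ≤⟨ *-monoʳ-≤ a H≤n ⟩
  a * n ≤⟨ an≤Hd ⟩
  H * d ∎)
  where open ≤-Reasoning

2h<5h∸c : ∀ h c → c < 3 * h → 2 * h < 5 * h ∸ c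
2h<5h∸c h c c<3h = m+n≤o⇒m≤o∸n (suc (2 * h)) (begin
  suc (2 * h + c) ≡⟨ +-suc (2 * h) c ⟨
  2 * h + suc c   ≤⟨ +-monoʳ-≤ (2 * h) c<3h ⟩
  2 * h + 3 * h   ≡⟨ *-distribʳ-+ h 2 3 ⟨
  5 * h ∎)
  where open ≤-Reasoning

x+1+[x∸3]≡[x∸1]+[x∸1] : ∀ x → 3 ≤ x → (x + 1) + (x ∸ 3) ≡ (x ∸ 1) + (x ∸ 1)
x+1+[x∸3]≡[x∸1]+[x∸1] (suc (suc (suc y))) (s≤s (s≤s (s≤s z≤n))) = identity y
  where
  identity : ∀ y → (3 + y + 1) + y ≡ (2 + y) + (2 + y)
  identity = solve-∀

minDegree>2h : ∀ {h n d} → 1 ≤ h → 10 * h ≤ n → (5 * h ∸ 1) * n ≤ 10 * h * d → 2 * h < d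
minDegree>2h {h@(suc _)} h≥1 =
  m<d-by-scaling (2h<5h∸c h 1 (≤-trans (m≤m+n 2 1) (*-monoʳ-≤ 3 h≥1)))

overlap>2h : ∀ {h n d₁ d₂ c o t} → 2 ≤ h → 10 * h ≤ n →
  (5 * h ∸ 1) * n ≤ 10 * h * d₁ → (5 * h ∸ 1) * n ≤ 10 * h * d₂ →
  10 * h * t ≤ (5 * h + 1) * n → c + o ≡ d₁ + d₂ → o ≤ t → 2 * h < c
overlap>2h {h@(suc _)} {n} {d₁} {d₂} {c} {o} {t} h≥2 10h≤n δ₁ δ₂ t≤ c+o≡d₁+d₂ o≤t =
  m<d-by-scaling (2h<5h∸c h 3 (≤-trans (m≤m+n 4 2) (*-monoʳ-≤ 3 h≥2))) 10h≤n
    (+-cancelˡ-≤ ((5 * h + 1) * n) _ _ (begin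
      (5 * h + 1) * n + (5 * h ∸ 3) * n  ≡⟨ *-distribʳ-+ n (5 * h + 1) (5 * h ∸ 3) ⟨
      ((5 * h + 1) + (5 * h ∸ 3)) * n    ≡⟨ cong (_* n) (x+1+[x∸3]≡[x∸1]+[x∸1] (5 * h) 3≤5h) ⟩
      (F + F) * n                        ≡⟨ *-distribʳ-+ n F F ⟩
      F * n + F * n                      ≤⟨ +-mono-≤ δ₁ δ₂ ⟩
      H * d₁ + H * d₂                    ≡⟨ *-distribˡ-+ H d₁ d₂ ⟨
      H * (d₁ + d₂)                      ≡⟨ cong (H *_) c+o≡d₁+d₂ ⟨
      H * (c + o)                        ≡⟨ *-distribˡ-+ H c o ⟩
      H * c + H * o                      ≤⟨ +-monoʳ-≤ (H * c) (≤-trans (*-monoʳ-≤ H o≤t) t≤) ⟩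
      H * c + (5 * h + 1) * n            ≡⟨ +-comm (H * c) _ ⟩
      (5 * h + 1) * n + H * c            ∎))
  where
  open ≤-Reasoning
  H F : ℕ
  H = 10 * h
  F = 5 * h ∸ 1
  3≤5h : 3 ≤ 5 * h
  3≤5h = ≤-trans (m≤m+n 3 7) (*-monoʳ-≤ 5 h≥2)

Nbr : Graph N → Fin N → Subset N
Nbr G x = tabulate (adj G x)

Vside : (Fin N → Bool) → Subset N
Vside side = tabulate (not ∘ side)

does-≟true : ∀ b → does (b ≟B true) ≡ b
does-≟true true  = refl
does-≟true false = refl

does-≟false : ∀ b → does (b ≟B false) ≡ not b
does-≟false true  = refl
does-≟false false = refl

degree≡∣Nbr∣ : (G : Graph N) (x : Fin N) → degree G x ≡ ∣ Nbr G x ∣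
degree≡∣Nbr∣ G x =
  trans (length-filter-tabulate (λ y → adj G x y ≟B true) id)
        (cong ∣_∣ (tabulate-cong (does-≟true ∘ adj G x)))

sizeV≡∣Vside∣ : (side : Fin N → Bool) → sizeV side ≡ ∣ Vside side ∣
sizeV≡∣Vside∣ side =
  trans (length-filter-tabulate (λ y → side y ≟B false) id)
        (cong ∣_∣ (tabulate-cong (does-≟false ∘ side)))

module _ (G : Graph N) (side : Fin N → Bool) (bip : IsBipartition G side) where

  neighbour-side : ∀ {x y} → adj G x y ≡ true → side y ≡ not (side x)
  neighbour-side {x} {y} xy = ¬-not (bip x y xy ∘ sym)

  Nbr⊆Vside : ∀ {x} → side x ≡ true → Nbr G x ⊆ Vside side
  Nbr⊆Vside x∈U y∈Nx =
    ∈-tabulate⁺ (trans (cong not (neighbour-side (∈-tabulate⁻ y∈Nx))) (cong (not ∘ not) x∈U))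

  Nbr∪Nbr⊆Vside : ∀ {x y} → side x ≡ true → side y ≡ true → Nbr G x ∪ Nbr G y ⊆ Vside side
  Nbr∪Nbr⊆Vside x∈U y∈U = [ Nbr⊆Vside x∈U , Nbr⊆Vside y∈U ] ∘ x∈p∪q⁻ _ _

trivialPath : (G : Graph N) (x : Fin N) → Path G 0 x x
trivialPath G x = record
  { vtx = λ _ → x ; inj = λ { {zero} {zero} _ → refl } ; start = refl ; end = refl ; edges = λ () }

prepend : {G : Graph N} {a v : Fin N} (P : Path G m a v) (x : Fin N) →
  adj G x a ≡ true → (∀ i → vtx P i ≢ x) → Path G (suc m) x v
prepend {m = m} {G = G} P x xa x∉P = record
  { vtx = vtx′ ; inj = inj′ ; start = refl ; end = end P ; edges = edges′ }
  where
  vtx′ : Fin (suc (suc m)) → Fin _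
  vtx′ zero    = x
  vtx′ (suc i) = vtx P i
  inj′ : ∀ {i j} → vtx′ i ≡ vtx′ j → i ≡ j
  inj′ {zero}  {zero}  _ = refl
  inj′ {zero}  {suc j} e = contradiction (sym e) (x∉P j)
  inj′ {suc i} {zero}  e = contradiction e (x∉P i)
  inj′ {suc i} {suc j} e = cong suc (inj P e)
  edges′ : ∀ i → adj G (vtx′ (inject₁ i)) (vtx′ (suc i)) ≡ true
  edges′ zero    = subst (λ a → adj G x a ≡ true) (sym (start P)) xa
  edges′ (suc i) = edges P i

module GreedyPath (G : Graph N) (side : Fin N → Bool) (bip : IsBipartition G side) (s : ℕ)
  (degree> : ∀ x → s < ∣ Nbr G x ∣)
  (common> : ∀ x y → side x ≡ true → side y ≡ true → s < ∣ Nbr G x ∩ Nbr G y ∣)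
  (B : Subset N) {u v : Fin N} (u≢v : u ≢ v) where

  record Tail (m : ℕ) : Set where
    field
      head       : Fin N
      path       : Path G m head v
      visited    : Subset N
      ∣visited∣≤ : ∣ visited ∣ ≤ suc m
      on-path    : ∀ i → vtx path i ∈ visited
      avoids     : ∀ i → vtx path i ∈ B ∪ ⁅ u ⁆ → vtx path i ≡ v
      side-head  : side head ≡ fold (side v) not m
  open Tail

  blocked : Tail m → Subset N
  blocked t = (B ∪ ⁅ u ⁆) ∪ visited t

  ∣blocked∣≤ : (t : Tail m) → ∣ blocked t ∣ ≤ ∣ B ∣ + (2 + m)
  ∣blocked∣≤ {m} t = begin
    ∣ (B ∪ ⁅ u ⁆) ∪ visited t ∣       ≤⟨ ∣p∪q∣≤∣p∣+∣q∣ (B ∪ ⁅ u ⁆) (visited t) ⟩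
    ∣ B ∪ ⁅ u ⁆ ∣ + ∣ visited t ∣     ≤⟨ +-mono-≤ (∣p∪q∣≤∣p∣+∣q∣ B ⁅ u ⁆) (∣visited∣≤ t) ⟩
    (∣ B ∣ + ∣ ⁅ u ⁆ ∣) + suc m       ≡⟨ cong (λ k → (∣ B ∣ + k) + suc m) (∣⁅x⁆∣≡1 u) ⟩
    (∣ B ∣ + 1) + suc m               ≡⟨ +-assoc ∣ B ∣ 1 (suc m) ⟩
    ∣ B ∣ + (2 + m)                   ∎
    where open ≤-Reasoning

  record Fresh (t : Tail m) (p : Subset N) : Set where
    field
      vertex   : Fin N
      ∈p       : vertex ∈ p
      ∉B∪u     : vertex ∉ B ∪ ⁅ u ⁆
      off-path : ∀ i → vtx (path t) i ≢ vertex

  fresh : (t : Tail m) → ∣ B ∣ + (2 + m) ≤ s → (p : Subset N) → s < ∣ p ∣ → Fresh t p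
  fresh t room p s<∣p∣ with pigeonhole (≤-<-trans (≤-trans (∣blocked∣≤ t) room) s<∣p∣)
  ... | x , x∈p , x∉blocked = record
    { vertex   = x
    ; ∈p       = x∈p
    ; ∉B∪u     = x∉blocked ∘ x∈p∪q⁺ ∘ inj₁
    ; off-path = λ i e → x∉blocked (x∈p∪q⁺ (inj₂ (subst (_∈ visited t) e (on-path t i))))
    }

  trivialTail : Tail 0
  trivialTail = record
    { head = v ; path = trivialPath G v ; visited = ⁅ v ⁆ ; ∣visited∣≤ = ≤-reflexive (∣⁅x⁆∣≡1 v)
    ; on-path = λ _ → x∈⁅x⁆ v ; avoids = λ _ _ → refl ; side-head = refl }

  extend : (t : Tail m) → ∣ B ∣ + (2 + m) ≤ s → Tail (suc m)
  extend {m} t room = record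
    { head       = x
    ; path       = prepend (path t) x (trans (Graph.sym G x (head t)) (∈-tabulate⁻ ∈p)) off-path
    ; visited    = ⁅ x ⁆ ∪ visited t
    ; ∣visited∣≤ = ≤-trans (∣p∪q∣≤∣p∣+∣q∣ ⁅ x ⁆ (visited t))
                     (≤-trans (+-monoʳ-≤ ∣ ⁅ x ⁆ ∣ (∣visited∣≤ t)) (≤-reflexive (cong (_+ suc m) (∣⁅x⁆∣≡1 x))))
    ; on-path    = λ { zero → x∈p∪q⁺ (inj₁ (x∈⁅x⁆ x)) ; (suc i) → x∈p∪q⁺ (inj₂ (on-path t i)) }
    ; avoids     = λ { zero x∈ → contradiction x∈ ∉B∪u ; (suc i) → avoids t i }
    ; side-head  = trans (neighbour-side G side bip (∈-tabulate⁻ ∈p)) (cong not (side-head t))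
    }
    where open Fresh (fresh t room (Nbr G (head t)) (degree> (head t))) renaming (vertex to x)

  tail : ∀ m → ∣ B ∣ + (2 + m) ≤ s → Tail m
  tail zero    _    = trivialTail
  tail (suc m) room = extend (tail m room′) room′
    where
    room′ : ∣ B ∣ + (2 + m) ≤ s
    room′ = ≤-trans (+-monoʳ-≤ ∣ B ∣ (n≤1+n (2 + m))) room

  ≡u⇒∈B∪u : ∀ {w} → w ≡ u → w ∈ B ∪ ⁅ u ⁆
  ≡u⇒∈B∪u refl = x∈p∪q⁺ (inj₂ (x∈⁅x⁆ u))

  path-of-length : ∀ m → ∣ B ∣ + (2 + m) ≤ s → side u ≡ true → side u ≡ fold (side v) not (2 + m) →
    ∃ λ (P : Path G (2 + m) u v) → AvoidsInterior P B
  path-of-length m room u∈U parity = P , P-avoids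
    where
    t : Tail m
    t = tail m room
    head∈U : side (head t) ≡ true
    head∈U = trans (side-head t) (trans (sym (not-involutive _)) (trans (sym parity) u∈U))
    open Fresh (fresh t room (Nbr G u ∩ Nbr G (head t)) (common> u (head t) u∈U head∈U))
      renaming (vertex to y)
    y∈Nu×y∈Nhead : y ∈ Nbr G u × y ∈ Nbr G (head t)
    y∈Nu×y∈Nhead = x∈p∩q⁻ _ _ ∈p
    P₁ : Path G (suc m) y v
    P₁ = prepend (path t) y (trans (Graph.sym G y (head t)) (∈-tabulate⁻ (proj₂ y∈Nu×y∈Nhead))) off-path
    u∉P₁ : ∀ i → vtx P₁ i ≢ u
    u∉P₁ zero    y≡u = ∉B∪u (≡u⇒∈B∪u y≡u)
    u∉P₁ (suc i) w≡u = u≢v (trans (sym w≡u) (avoids t i (≡u⇒∈B∪u w≡u)))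
    P : Path G (2 + m) u v
    P = prepend P₁ u (∈-tabulate⁻ (proj₁ y∈Nu×y∈Nhead)) u∉P₁
    P-avoids : AvoidsInterior P B
    P-avoids zero          _   = inj₁ refl
    P-avoids (suc zero)    y∈B = contradiction (x∈p∪q⁺ (inj₁ y∈B)) ∉B∪u
    P-avoids (suc (suc i)) w∈B = inj₂ (avoids t i (x∈p∪q⁺ (inj₁ w∈B)))

fold-not-2* : ∀ k b → fold b not (2 * k) ≡ b
fold-not-2* zero    b = refl
fold-not-2* (suc k) b =
  trans (cong (fold b not) (*-suc 2 k)) (trans (not-involutive _) (fold-not-2* k b))

lemma3p4 : (h n : ℕ) → 1 ≤ h → 1 ≤ n → n ≥ 10 * h →
    {N : ℕ} (G : Graph N) (side : Fin N → Bool) → IsBipartition G side →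
    (W : Subset N) → ∣ W ∣ ≡ h →
    (5 * h ∸ 1) * n ≤ (10 * h) * sizeU side → (10 * h) * sizeU side ≤ (5 * h + 1) * n →
    (5 * h ∸ 1) * n ≤ (10 * h) * sizeV side → (10 * h) * sizeV side ≤ (5 * h + 1) * n →
    (∀ x → (5 * h ∸ 1) * n ≤ (10 * h) * degree G x) →
    (∀ (u v : Fin N) → side u ≡ true → side v ≡ false →
       ∀ l → Odd l → 3 ≤ l → l ≤ h →
       ∃ λ (P : Path G l u v) → AvoidsInterior P W)
    × (∀ (u v : Fin N) → side u ≡ true → side v ≡ true → u ≢ v →
       ∀ l → Even l → 2 ≤ l → l ≤ h →
       ∃ λ (P : Path G l u v) → AvoidsInterior P W)
lemma3p4 h n h≥1 _ 10h≤n G side bip W ∣W∣≡h _ _ _ 10h∣V∣≤ δ = odd-paths , even-paths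
  where
  δ′ : ∀ x → (5 * h ∸ 1) * n ≤ 10 * h * ∣ Nbr G x ∣
  δ′ x = subst (λ d → _ ≤ 10 * h * d) (degree≡∣Nbr∣ G x) (δ x)

  common> : 2 ≤ h → ∀ x y → side x ≡ true → side y ≡ true → 2 * h < ∣ Nbr G x ∩ Nbr G y ∣
  common> h≥2 x y x∈U y∈U = overlap>2h h≥2 10h≤n (δ′ x) (δ′ y)
    (subst (λ t → 10 * h * t ≤ _) (sizeV≡∣Vside∣ side) 10h∣V∣≤)
    (∣p∩q∣+∣p∪q∣≡∣p∣+∣q∣ (Nbr G x) (Nbr G y))
    (p⊆q⇒∣p∣≤∣q∣ (Nbr∪Nbr⊆Vside G side bip x∈U y∈U))

  paths : ∀ {u v} l → side u ≡ true → side u ≡ fold (side v) not l → u ≢ v → 2 ≤ l → l ≤ h →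
    ∃ λ (P : Path G l u v) → AvoidsInterior P W
  paths 1             _   _      _   (s≤s ())
  paths (suc (suc m)) u∈U parity u≢v 2≤l l≤h =
    GreedyPath.path-of-length G side bip (2 * h) (λ x → minDegree>2h h≥1 10h≤n (δ′ x))
      (common> (≤-trans 2≤l l≤h)) W u≢v m room u∈U parity
    where
    room : ∣ W ∣ + (2 + m) ≤ 2 * h
    room = ≤-trans (+-mono-≤ (≤-reflexive ∣W∣≡h) l≤h) (≤-reflexive (cong (h +_) (sym (+-identityʳ h))))

  odd-paths : ∀ u v → side u ≡ true → side v ≡ false → ∀ l → Odd l → 3 ≤ l → l ≤ h →
    ∃ λ (P : Path G l u v) → AvoidsInterior P W
  odd-paths u v u∈U v∈V l (k , refl) 3≤l =
    paths l u∈U (trans u∈U (cong not (sym (trans (fold-not-2* k (side v)) v∈V)))) u≢v (≤-trans (n≤1+n 2) 3≤l)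
    where
    u≢v : u ≢ v
    u≢v u≡v = contradiction (trans (sym u∈U) (trans (cong side u≡v) v∈V)) λ ()

  even-paths : ∀ u v → side u ≡ true → side v ≡ true → u ≢ v → ∀ l → Even l → 2 ≤ l → l ≤ h →
    ∃ λ (P : Path G l u v) → AvoidsInterior P W
  even-paths u v u∈U v∈U u≢v l (k , refl) =
    paths l u∈U (trans (trans u∈U (sym v∈U)) (sym (fold-not-2* k (side v)))) u≢v
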